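{- The variety generated by the idempotent rectangular groupoids is a proper subvariety of the variety of all idempotent groupoids.
   Context: A groupoid $(A,*)$ is a rectangular groupoid if for all $a,b,c,d,x\in A$: $a*b=c*d=x$ implies $a*d=c*b=x$. A groupoid is idempotent if $a*a=a$ for all $a$. -}

module Defs where

open import Data.Nat using (ℕ)
open import Data.Product using (Σ; _×_; _,_)
open import Relation.Binary.PropositionalEquality using (_≡_)
open import Relation.Nullary using (¬_)
open import Level using (Level; suc; _⊔_)

record Groupoid : Set₁ where
  field
    Carrier : Set
    _*_     : Carrier → Carrier → Carrier

module _ (G : Groupoid) where
  open Groupoid G

  IsIdempotent : Set
  IsIdempotent = ∀ a → a * a ≡ a

  IsRectangular : Set
  IsRectangular = ∀ a b c d x → a * b ≡ x → c * d ≡ x → (a * d ≡ x) × (c * b ≡ x)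

data Term : Set where
  var : ℕ → Term
  _·_ : Term → Term → Term

record Identity : Set where
  constructor _≈_
  field
    lhs rhs : Term

eval : (G : Groupoid) → (ℕ → Groupoid.Carrier G) → Term → Groupoid.Carrier G
eval G ρ (var i) = ρ i
eval G ρ (s · t) = Groupoid._*_ G (eval G ρ s) (eval G ρ t)

_⊨_ : Groupoid → Identity → Set
G ⊨ (s ≈ t) = ∀ (ρ : ℕ → Groupoid.Carrier G) → eval G ρ s ≡ eval G ρ t

Class : Set₂
Class = Groupoid → Set₁

EqOf : Class → Identity → Set₁
EqOf K e = ∀ G → K G → G ⊨ e

ModOf : (Identity → Set₁) → Class
ModOf E G = ∀ e → E e → G ⊨ e

-- The variety generated by K, V(K) = Mod(Eq(K))  (= HSP(K) by Birkhoff).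
VarietyGenBy : Class → Class
VarietyGenBy K = ModOf (EqOf K)

IdempotentGroupoid : Class
IdempotentGroupoid G = Level.Lift _ (IsIdempotent G)

IdempotentRectangularGroupoid : Class
IdempotentRectangularGroupoid G = Level.Lift _ (IsIdempotent G × IsRectangular G)

_⊆ᶜ_ : Class → Class → Set₁
K ⊆ᶜ L = ∀ G → K G → L G

_⊂ᶜ_ : Class → Class → Set₁
K ⊂ᶜ L = (K ⊆ᶜ L) × Σ Groupoid (λ G → L G × ¬ K G)

module Submission where

-- Inclusion: the identity x·x ≈ x holds throughout K, hence in every model of
-- Eq(K), and an algebra satisfying x·x ≈ x is idempotent.
--
-- Properness: in an idempotent rectangular groupoid, a·b = x and x·x = x give,
-- by rectangularity, a·x = x, i.e. the left absorption law x·(x·y) ≈ x·y holds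
-- in K and hence in V(K).  A three-element idempotent groupoid in which
-- 0·1 = 2, 0·2 = 1 and all other products are the left factor violates this
-- law (0·(0·1) = 1 ≠ 2 = 0·1), so it is idempotent but not in V(K).

open import Defs
open import Data.Nat using (ℕ; zero; suc)
open import Data.Product using (_×_; _,_; proj₁)
open import Relation.Binary.PropositionalEquality using (_≡_; refl)
open import Relation.Nullary using (¬_)
open import Level using (lift)

varietySatisfies : ∀ {K} e → EqOf K e → ∀ G → VarietyGenBy K G → G ⊨ e
varietySatisfies e valid G inV = inV e valid

idempotentLaw : Identity
idempotentLaw = (var 0 · var 0) ≈ var 0

leftAbsorptionLaw : Identity
leftAbsorptionLaw = (var 0 · (var 0 · var 1)) ≈ (var 0 · var 1)

satisfiesIdempotentLaw⇒idempotent : ∀ G → G ⊨ idempotentLaw → IsIdempotent G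
satisfiesIdempotentLaw⇒idempotent G sat a = sat (λ _ → a)

leftAbsorption : ∀ G → IsIdempotent G → IsRectangular G →
                 let open Groupoid G in ∀ a b → a * (a * b) ≡ a * b
leftAbsorption G idem rect a b = proj₁ (rect a b (a * b) (a * b) (a * b) refl (idem (a * b)))
  where open Groupoid G

idempotentLawInK : EqOf IdempotentRectangularGroupoid idempotentLaw
idempotentLawInK G (lift (idem , _)) ρ = idem (ρ 0)

leftAbsorptionLawInK : EqOf IdempotentRectangularGroupoid leftAbsorptionLaw
leftAbsorptionLawInK G (lift (idem , rect)) ρ = leftAbsorption G idem rect (ρ 0) (ρ 1)

data Three : Set where
  t0 t1 t2 : Three

_∘₃_ : Three → Three → Three
t0 ∘₃ t1 = t2
t0 ∘₃ t2 = t1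
x  ∘₃ _  = x

threeGroupoid : Groupoid
threeGroupoid = record { Carrier = Three ; _*_ = _∘₃_ }

threeIdempotent : IsIdempotent threeGroupoid
threeIdempotent t0 = refl
threeIdempotent t1 = refl
threeIdempotent t2 = refl

-- Under x ↦ 0, y ↦ 1 the left absorption law reads 0·(0·1) = 1 ≡ 2 = 0·1.
zeroOne : ℕ → Three
zeroOne zero    = t0
zeroOne (suc _) = t1

threeViolatesLeftAbsorption : ¬ (threeGroupoid ⊨ leftAbsorptionLaw)
threeViolatesLeftAbsorption sat with sat zeroOne
... | ()

mainTheorem9 : VarietyGenBy IdempotentRectangularGroupoid ⊂ᶜ IdempotentGroupoid
mainTheorem9 = inclusion , threeGroupoid , lift threeIdempotent , threeNotInV
  where
  inclusion : VarietyGenBy IdempotentRectangularGroupoid ⊆ᶜ IdempotentGroupoid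
  inclusion G inV = lift (satisfiesIdempotentLaw⇒idempotent G
                            (varietySatisfies idempotentLaw idempotentLawInK G inV))

  threeNotInV : ¬ VarietyGenBy IdempotentRectangularGroupoid threeGroupoid
  threeNotInV inV = threeViolatesLeftAbsorption
                      (varietySatisfies leftAbsorptionLaw leftAbsorptionLawInK threeGroupoid inV)
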